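{- Let $\Omega$ be a finite set with $|\Omega|>2$ and let $S$ be any generating set of $\operatorname{Sym}(\Omega)$. Then the cycle type graph $\mathcal{C}(S)$ is asymmetric, i.e. $\operatorname{Aut}(\mathcal{C}(S))$ is trivial.
   Context: For $g\in\operatorname{Sym}(\Omega)$, $\operatorname{supp}(g)=\{x:g(x)\neq x\}$. Enumerate $S=\{s_1,\dots,s_m\}$. The cycle type graph $\mathcal{C}(S)$ is the vertex-colored mixed graph with vertex set the disjoint union $\Omega\,\dot\cup\,\dot\bigcup_{i=1}^m\{(i,x):x\in\operatorname{supp}(s_i)\}$; each copy $(i,x)$ is joined by an undirected edge to $x\in\Omega$; there are directed edges $(i,x)\to(i,s_i(x))$ for all $x\in\operatorname{supp}(s_i)$; vertices of $\Omega$ get color $0$ and $(i,x)$ gets color $(i,t)$ where $t$ is the length of the cycle of $s_i$ containing $x$. An automorphism of $\mathcal{C}(S)$ is a bijection of its vertices preserving colors, undirected edges, and directed edges (with direction). -}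

module Defs where

open import Data.Nat using (ℕ; zero; suc; _<_)
open import Data.Fin using (Fin; _≟_)
open import Data.Fin.Permutation using (Permutation′; _⟨$⟩ʳ_; _⟨$⟩ˡ_)
open import Data.Bool using (Bool; true; false)
open import Data.List using (List; []; _∷_)
open import Data.Product using (Σ; _×_; _,_; ∃)
open import Data.Sum using (_⊎_; inj₁; inj₂)
open import Data.Empty using (⊥)
open import Relation.Nullary using (¬_)
open import Relation.Nullary.Decidable using (False)
open import Relation.Binary.PropositionalEquality using (_≡_; _≢_)
open import Function.Bundles using (_↔_; _⇔_; Inverse)

-- Ω = Fin n.  S = {s_1,…,s_m} is enumerated as a function Fin m → Permutation′ n.

iter : ∀ {A : Set} → (A → A) → ℕ → A → A
iter f zero    x = x
iter f (suc k) x = f (iter f k x)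

-- words in the generators and their inverses (true = generator, false = inverse)
evalWord : ∀ {m n} → (Fin m → Permutation′ n) → List (Fin m × Bool) → Fin n → Fin n
evalWord S []                  x = x
evalWord S ((i , true)  ∷ w) x = S i ⟨$⟩ʳ evalWord S w x
evalWord S ((i , false) ∷ w) x = S i ⟨$⟩ˡ evalWord S w x

Generates : ∀ {m n} → (Fin m → Permutation′ n) → Set
Generates {m} {n} S = (g : Permutation′ n) →
  ∃ λ (w : List (Fin m × Bool)) → ∀ x → evalWord S w x ≡ g ⟨$⟩ʳ x

Distinct : ∀ {m n} → (Fin m → Permutation′ n) → Set
Distinct {m} {n} S = ∀ i j → (∀ x → S i ⟨$⟩ʳ x ≡ S j ⟨$⟩ʳ x) → i ≡ j

IsCycleLength : ∀ {n} → (Fin n → Fin n) → Fin n → ℕ → Set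
IsCycleLength f x t = (0 < t) × (iter f t x ≡ x) × (∀ k → 0 < k → k < t → iter f k x ≢ x)

-- vertices of the cycle type graph: Ω ⊎ {(i,x) : x ∈ supp(s_i)}
-- (membership in the support is witnessed by the proof-irrelevant False (s_i x ≟ x))
Copy : ∀ {m n} → (Fin m → Permutation′ n) → Set
Copy {m} {n} S = Σ (Fin m) λ i → Σ (Fin n) λ x → False ((S i ⟨$⟩ʳ x) ≟ x)

Vertex : ∀ {m n} → (Fin m → Permutation′ n) → Set
Vertex {m} {n} S = Fin n ⊎ Copy S

data Color (m : ℕ) : Set where
  base : Color m
  copy : Fin m → ℕ → Color m

HasColor : ∀ {m n} (S : Fin m → Permutation′ n) → Vertex S → Color m → Set
HasColor S (inj₁ x)           c = c ≡ base
HasColor S (inj₂ (i , x , _)) c =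
  Σ ℕ λ t → (c ≡ copy i t) × IsCycleLength (λ y → S i ⟨$⟩ʳ y) x t

UEdge : ∀ {m n} (S : Fin m → Permutation′ n) → Vertex S → Vertex S → Set
UEdge S (inj₁ y)           (inj₂ (i , x , _)) = x ≡ y
UEdge S (inj₂ (i , x , _)) (inj₁ y)           = x ≡ y
UEdge S _                  _                  = ⊥

DEdge : ∀ {m n} (S : Fin m → Permutation′ n) → Vertex S → Vertex S → Set
DEdge S (inj₂ (i , x , _)) (inj₂ (j , y , _)) = (i ≡ j) × (S i ⟨$⟩ʳ x ≡ y)
DEdge S _                  _                  = ⊥

IsAutomorphism : ∀ {m n} (S : Fin m → Permutation′ n) → (Vertex S ↔ Vertex S) → Set
IsAutomorphism S φ =
  (∀ v c → HasColor S v c ⇔ HasColor S (f v) c) ×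
  (∀ u v → UEdge S u v ⇔ UEdge S (f u) (f v)) ×
  (∀ u v → DEdge S u v ⇔ DEdge S (f u) (f v))
  where f = Inverse.to φ

Asymmetric : ∀ {m n} (S : Fin m → Permutation′ n) → Set
Asymmetric S = ∀ (φ : Vertex S ↔ Vertex S) → IsAutomorphism S φ → ∀ v → Inverse.to φ v ≡ v

-- An automorphism preserves colours, so it permutes the points of Ω by some π and sends
-- each copy (i , x) to a copy (i , π x). Directed edges give s_i (π x) = π (s_i x) for x in
-- the support of s_i; off the support both sides are π x, because every copy has a preimage
-- and hence π x ∈ supp(s_i) forces x ∈ supp(s_i). So π centralises the generators, hence
-- all of Sym(Ω), whose centre is trivial when |Ω| > 2. Thus π = id, and since a copy is
-- determined by its index and its point, the automorphism is the identity.
module Submission where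

open import Defs
open import Data.Nat using (ℕ; _<_)
open import Data.Fin using (Fin)
open import Data.Fin.Permutation using (Permutation′)

open import Level using (Level)
open import Data.Nat using (zero; suc; _+_; _∸_; s≤s)
open import Data.Nat.Properties
  using (_<?_; n<1+n; <⇒≤; <-≤-trans; m<n⇒0<n∸m; m+[n∸m]≡n; anyUpTo?)
open import Data.Fin as Fin using (toℕ; _≟_; punchIn; punchOut)
open import Data.Fin.Properties using (pigeonhole; punchInᵢ≢i; punchIn-injective; punchIn-punchOut)
open import Data.Fin.Permutation using (_⟨$⟩ʳ_; _⟨$⟩ˡ_; transpose; inverseˡ; inverseʳ)
open import Data.Bool using (Bool; true; false)
open import Data.Bool.Properties using (T-irrelevant)
open import Data.List using (List; []; _∷_)
open import Data.Product using (_×_; _,_; ∃; ∃₂; proj₁; proj₂)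
open import Data.Sum using (inj₁; inj₂)
open import Data.Empty using (⊥-elim)
open import Relation.Nullary using (¬_; yes; no)
open import Relation.Nullary.Decidable using (False; _×-dec_; toWitnessFalse; fromWitnessFalse; dec-true; dec-false)
open import Relation.Unary using (Pred; Decidable)
open import Relation.Binary.PropositionalEquality
open import Function.Bundles using (_↔_; Inverse; Injection; Equivalence)
open import Function.Definitions using (Injective)
open import Function.Base using (_∘_)
open import Function.Properties.Inverse using (↔⇒↣)

private
  variable
    p : Level
    A : Set
    m n : ℕ

module _ {P : Pred ℕ p} (P? : Decidable P) where

  least-witness : ∀ v → (∃ λ k → k < v × P k) → ∃ λ k → P k × (∀ j → j < k → ¬ P j)
  least-witness (suc v) (k , s≤s k≤v , Pk) with anyUpTo? P? v
  ... | yes below = least-witness v below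
  ... | no ¬below = k , Pk , λ j j<k Pj → ¬below (j , <-≤-trans j<k k≤v , Pj)

iter-+ : ∀ (f : A → A) k a x → iter f (k + a) x ≡ iter f k (iter f a x)
iter-+ f zero    a x = refl
iter-+ f (suc k) a x = cong f (iter-+ f k a x)

iter-injective : ∀ {f : A → A} → Injective _≡_ _≡_ f → ∀ k → Injective _≡_ _≡_ (iter f k)
iter-injective f-inj zero    eq = eq
iter-injective f-inj (suc k) eq = iter-injective f-inj k (f-inj eq)

module _ {f : Fin n → Fin n} (f-inj : Injective _≡_ _≡_ f) where

  -- Two of the n + 1 points x, f x, …, fⁿ x coincide; cancel the shorter iterate.
  iter-returns : ∀ x → ∃ λ t → 0 < t × iter f t x ≡ x
  iter-returns x with i , j , i<j , fⁱx≡fʲx ← pigeonhole (n<1+n n) (λ k → iter f (toℕ k) x)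
    = toℕ j ∸ toℕ i , m<n⇒0<n∸m i<j , iter-injective f-inj (toℕ i) returns
    where
    open ≡-Reasoning
    returns : iter f (toℕ i) (iter f (toℕ j ∸ toℕ i) x) ≡ iter f (toℕ i) x
    returns = begin
      iter f (toℕ i) (iter f (toℕ j ∸ toℕ i) x) ≡⟨ iter-+ f (toℕ i) _ x ⟨
      iter f (toℕ i + (toℕ j ∸ toℕ i)) x        ≡⟨ cong (λ k → iter f k x) (m+[n∸m]≡n (<⇒≤ i<j)) ⟩
      iter f (toℕ j) x                          ≡⟨ fⁱx≡fʲx ⟨
      iter f (toℕ i) x                          ∎

  cycleLength : ∀ x → ∃ (IsCycleLength f x)
  cycleLength x with t , 0<t , fᵗx≡x ← iter-returns x
    with k , (0<k , fᵏx≡x) , minimal ← least-witness (λ k → 0 <? k ×-dec iter f k x ≟ x)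
                                         (suc t) (t , n<1+n t , 0<t , fᵗx≡x)
    = k , 0<k , fᵏx≡x , λ j 0<j j<k fʲx≡x → minimal j j<k (0<j , fʲx≡x)

permutation-injective : (σ : Permutation′ n) → Injective _≡_ _≡_ (σ ⟨$⟩ʳ_)
permutation-injective σ = Injection.injective (↔⇒↣ σ)

transpose-sends : (i j : Fin n) → transpose i j ⟨$⟩ʳ i ≡ j
transpose-sends i j rewrite dec-true (i ≟ i) refl = refl

transpose-fixes : ∀ {i j k : Fin n} → k ≢ i → k ≢ j → transpose i j ⟨$⟩ʳ k ≡ k
transpose-fixes {i = i} {j} {k} k≢i k≢j rewrite dec-false (k ≟ i) k≢i | dec-false (k ≟ j) k≢j = refl

avoid-two : 2 < n → (a b : Fin n) → ∃ λ z → z ≢ a × z ≢ b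
avoid-two {suc (suc (suc _))} _ a b with a ≟ b
... | yes refl = punchIn a Fin.zero , punchInᵢ≢i a Fin.zero , punchInᵢ≢i a Fin.zero
... | no a≢b = punchIn a c , punchInᵢ≢i a c , c≢b
  where
  b′ = punchOut a≢b
  c = punchIn b′ Fin.zero
  c≢b : punchIn a c ≢ b
  c≢b eq = punchInᵢ≢i b′ Fin.zero
             (punchIn-injective a c b′ (trans eq (sym (punchIn-punchOut a≢b))))
avoid-two {1} (s≤s ())
avoid-two {2} (s≤s (s≤s ()))

Commutes : Permutation′ n → (Fin n → Fin n) → Set
Commutes σ π = ∀ x → σ ⟨$⟩ʳ π x ≡ π (σ ⟨$⟩ʳ x)

commutes-inverse : ∀ (σ : Permutation′ n) {π} → Commutes σ π → ∀ x → σ ⟨$⟩ˡ π x ≡ π (σ ⟨$⟩ˡ x)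
commutes-inverse σ {π} σπ≡πσ x = begin
  σ ⟨$⟩ˡ π x                      ≡⟨ cong (λ y → σ ⟨$⟩ˡ π y) (inverseʳ σ) ⟨
  σ ⟨$⟩ˡ π (σ ⟨$⟩ʳ (σ ⟨$⟩ˡ x))      ≡⟨ cong (σ ⟨$⟩ˡ_) (σπ≡πσ (σ ⟨$⟩ˡ x)) ⟨
  σ ⟨$⟩ˡ (σ ⟨$⟩ʳ π (σ ⟨$⟩ˡ x))      ≡⟨ inverseˡ σ ⟩
  π (σ ⟨$⟩ˡ x)                    ∎
  where open ≡-Reasoning

module _ (S : Fin m → Permutation′ n) {π : Fin n → Fin n} (S-π : ∀ i → Commutes (S i) π) where

  commutes-evalWord : ∀ (w : List (Fin m × Bool)) x → evalWord S w (π x) ≡ π (evalWord S w x)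
  commutes-evalWord []              x = refl
  commutes-evalWord ((i , true) ∷ w) x =
    trans (cong (S i ⟨$⟩ʳ_) (commutes-evalWord w x)) (S-π i _)
  commutes-evalWord ((i , false) ∷ w) x =
    trans (cong (S i ⟨$⟩ˡ_) (commutes-evalWord w x)) (commutes-inverse (S i) (S-π i) _)

  centralises-generated : Generates S → ∀ h → Commutes h π
  centralises-generated S-gen h x with w , w≗h ← S-gen h =
    trans (sym (w≗h (π x))) (trans (commutes-evalWord w x) (cong π (w≗h x)))

-- If π x ≢ x, the transposition of π x with a third point z fixes x, so commuting with it forces z ≡ π x.
centraliser-trivial : 2 < n → ∀ (π : Fin n → Fin n) → (∀ h → Commutes h π) → ∀ x → π x ≡ x
centraliser-trivial 2<n π central x with π x ≟ x
... | yes πx≡x = πx≡x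
... | no πx≢x with z , z≢πx , z≢x ← avoid-two 2<n (π x) x = ⊥-elim (z≢πx z≡πx)
  where
  τ = transpose (π x) z
  z≡πx : z ≡ π x
  z≡πx = begin
    z           ≡⟨ transpose-sends (π x) z ⟨
    τ ⟨$⟩ʳ π x   ≡⟨ central τ x ⟩
    π (τ ⟨$⟩ʳ x) ≡⟨ cong π (transpose-fixes (πx≢x ∘ sym) (z≢x ∘ sym)) ⟩
    π x         ∎
    where open ≡-Reasoning

module Automorphism {S : Fin m → Permutation′ n} (φ : Vertex S ↔ Vertex S)
                    (φ-aut : IsAutomorphism S φ) where

  f : Vertex S → Vertex S
  f = Inverse.to φ

  preserves-colour : ∀ v c → HasColor S v c → HasColor S (f v) c
  preserves-colour v c = Equivalence.to (proj₁ φ-aut v c)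

  preserves-uedge : ∀ u v → UEdge S u v → UEdge S (f u) (f v)
  preserves-uedge u v = Equivalence.to (proj₁ (proj₂ φ-aut) u v)

  preserves-dedge : ∀ u v → DEdge S u v → DEdge S (f u) (f v)
  preserves-dedge u v = Equivalence.to (proj₂ (proj₂ φ-aut) u v)

  point↦point : ∀ x → ∃ λ y → f (inj₁ x) ≡ inj₁ y
  point↦point x with f (inj₁ x) | preserves-colour (inj₁ x) base refl
  ... | inj₁ y | _ = y , refl
  ... | inj₂ _ | _ , () , _

  π : Fin n → Fin n
  π x = proj₁ (point↦point x)

  f-point : ∀ x → f (inj₁ x) ≡ inj₁ (π x)
  f-point x = proj₂ (point↦point x)

  π-injective : Injective _≡_ _≡_ π
  π-injective {x} {y} πx≡πy
    with refl ← Injection.injective (↔⇒↣ φ) (trans (f-point x) (trans (cong inj₁ πx≡πy) (sym (f-point y))))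
    = refl

  copy-coloured : ∀ {i t} w → HasColor S w (copy i t) → ∃₂ λ y q → w ≡ inj₂ (i , y , q)
  copy-coloured (inj₂ (i , y , q)) (_ , refl , _) = y , q , refl

  f-copy : ∀ i x p → ∃ λ q → f (inj₂ (i , x , p)) ≡ inj₂ (i , π x , q)
  f-copy i x p with t , t-cycle ← cycleLength (permutation-injective (S i)) x
    with y , q , fv≡ ← copy-coloured (f (inj₂ (i , x , p)))
                         (preserves-colour (inj₂ (i , x , p)) (copy i t) (t , refl , t-cycle))
    with refl ← subst₂ (UEdge S) fv≡ (f-point x) (preserves-uedge (inj₂ (i , x , p)) (inj₁ x) refl)
    = q , fv≡

  copy-injective : ∀ {i j y z q r} → _≡_ {A = Vertex S} (inj₂ (i , y , q)) (inj₂ (j , z , r)) →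
                   i ≡ j × y ≡ z
  copy-injective refl = refl , refl

  support-reflected : ∀ i x → False (S i ⟨$⟩ʳ π x ≟ π x) → False (S i ⟨$⟩ʳ x ≟ x)
  support-reflected i x q
    with Inverse.from φ (inj₂ (i , π x , q)) | Inverse.strictlyInverseˡ φ (inj₂ (i , π x , q))
  ... | inj₁ z           | fz≡copy with () ← trans (sym (f-point z)) fz≡copy
  ... | inj₂ (j , z , r) | fz≡copy
    with _ , fz≡ ← f-copy j z r
    with refl , πz≡πx ← copy-injective (trans (sym fz≡) fz≡copy)
    with refl ← π-injective πz≡πx
    = r

  π-commutes : ∀ i → Commutes (S i) π
  π-commutes i x with S i ⟨$⟩ʳ x ≟ x
  ... | no x-moved = proj₂ (subst₂ (DEdge S) fv≡ fsv≡ (preserves-dedge v sv (refl , refl)))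
    where
    v  = inj₂ (i , x , fromWitnessFalse x-moved)
    sv = inj₂ (i , S i ⟨$⟩ʳ x , fromWitnessFalse (x-moved ∘ permutation-injective (S i)))
    fv≡  = proj₂ (f-copy i x _)
    fsv≡ = proj₂ (f-copy i (S i ⟨$⟩ʳ x) _)
  ... | yes x-fixed with S i ⟨$⟩ʳ π x ≟ π x
  ...   | yes πx-fixed = trans πx-fixed (cong π (sym x-fixed))
  ...   | no πx-moved =
    ⊥-elim (toWitnessFalse (support-reflected i x (fromWitnessFalse πx-moved)) x-fixed)

  fixes-all-vertices : (∀ x → π x ≡ x) → ∀ v → f v ≡ v
  fixes-all-vertices π≗id (inj₁ x) = trans (f-point x) (cong inj₁ (π≗id x))
  fixes-all-vertices π≗id (inj₂ (i , x , p)) with q , fv≡ ← f-copy i x p with π x | π≗id x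
  ... | _ | refl = trans fv≡ (cong (λ r → inj₂ (i , x , r)) (T-irrelevant q p))

corollary9 : (n : ℕ) → 2 < n → (m : ℕ) → (S : Fin m → Permutation′ n) →
    Distinct S → Generates S → Asymmetric S
corollary9 n 2<n m S _ S-gen φ φ-aut = fixes-all-vertices π-trivial
  where
  open Automorphism φ φ-aut
  π-trivial : ∀ x → π x ≡ x
  π-trivial = centraliser-trivial 2<n π (centralises-generated S π-commutes S-gen)
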